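{- Let $s\ge 1$ and $k\ge 1$. If $G$ is an $n$-vertex orientation with $\alpha(G)\le s$ and $G$ has fewer than $(k/(se))^k$ acyclic $k$-sets, then there is a permutation $\pi$ of $V(G)$ such that $\alpha(G_\pi)\le k$. In particular, $\chi(G_\pi)\ge n/k$.
   Context: An orientation is a digraph with no directed cycle of length $2$. Chromatic number and independence number of a digraph are those of its underlying undirected graph. A set $S$ of vertices is an acyclic $k$-set if $|S|=k$ and the induced subgraph $G[S]$ has no directed cycle. For a permutation $\pi$ of the vertices of $G$, $G_\pi$ is the spanning subgraph of $G$ consisting of all edges $(u,v)$ with $\pi(u)<\pi(v)$. -}

module Defs where

open import Data.Nat using (ℕ; zero; suc; _+_; _*_; _^_; _≤_; _<_)
open import Data.Fin using (Fin; zero; suc; toℕ; inject₁; fromℕ)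
open import Data.Fin.Subset using (Subset; _∈_; ∣_∣)
open import Data.Bool using (Bool; true; false; _∧_)
open import Data.Bool.Properties using (T?)
open import Data.Product using (Σ; ∃; _×_; _,_)
open import Data.Sum using (_⊎_)
open import Data.Nat using (_<ᵇ_)
open import Relation.Nullary using (¬_)
open import Relation.Binary.PropositionalEquality using (_≡_)
open import Function.Definitions using (Injective)
open import Function.Bundles using (_↔_)
open import Data.Refinement using (Refinement)

Digraph : ℕ → Set
Digraph n = Fin n → Fin n → Bool

-- Orientation: no directed cycle of length 2 (this also forbids loops,
-- take u = v).
IsOrientation : ∀ {n} → Digraph n → Set
IsOrientation {n} E = ∀ (u v : Fin n) → E u v ≡ true → E v u ≡ false

Adj : ∀ {n} → Digraph n → Fin n → Fin n → Set
Adj E u v = (E u v ≡ true) ⊎ (E v u ≡ true)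

Independent : ∀ {n} → Digraph n → Subset n → Set
Independent {n} E S = ∀ (u v : Fin n) → u ∈ S → v ∈ S → ¬ Adj E u v

IndepNumberLe : ∀ {n} → Digraph n → ℕ → Set
IndepNumberLe E s = ∀ S → Independent E S → ∣ S ∣ ≤ s

record DirectedCycleIn {n} (E : Digraph n) (S : Subset n) : Set where
  field
    m     : ℕ
    f     : Fin (suc m) → Fin n
    inj   : Injective _≡_ _≡_ f
    inS   : ∀ i → f i ∈ S
    step  : ∀ (i : Fin m) → E (f (inject₁ i)) (f (suc i)) ≡ true
    close : E (f (fromℕ m)) (f zero) ≡ true

AcyclicKSet : ∀ {n} → Digraph n → ℕ → Subset n → Set
AcyclicKSet E k S = (∣ S ∣ ≡ k) × ¬ DirectedCycleIn E S

-- The number of acyclic k-sets of E is N: a bijection between Fin N and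
-- the set of subsets that are acyclic k-sets (proofs irrelevant).
NumAcyclicKSets : ∀ {n} → Digraph n → ℕ → ℕ → Set
NumAcyclicKSets {n} E k N = Fin N ↔ Refinement (Subset n) (AcyclicKSet E k)

-- Comparison with Euler's number e, using that (1 + 1/j)^(j+1) decreases
-- strictly to e:  c · e^k < d  iff  ∃ j ≥ 1, c · ((j+1)/j)^((j+1)k) < d.
-- (Here j = i + 1.)
MulEPowLt : ℕ → ℕ → ℕ → Set
MulEPowLt c k d =
  ∃ λ i → c * (suc (suc i)) ^ (suc (suc i) * k) < d * (suc i) ^ (suc (suc i) * k)

-- N < (k/(s e))^k   iff   N · s^k · e^k < k^k
FewerThanBound : ℕ → ℕ → ℕ → Set
FewerThanBound N s k = MulEPowLt (N * s ^ k) k (k ^ k)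

Sub : ∀ {n} → Digraph n → (Fin n → Fin n) → Digraph n
Sub E π u v = E u v ∧ (toℕ (π u) <ᵇ toℕ (π v))

ProperColouring : ∀ {n} → Digraph n → (m : ℕ) → (Fin n → Fin m) → Set
ProperColouring {n} E m c = ∀ (u v : Fin n) → Adj E u v → ¬ (c u ≡ c v)

-- χ(G) ≥ n / k   iff  every proper m-colouring has n ≤ m · k
ChromaticGeDiv : ∀ {n} → Digraph n → ℕ → Set
ChromaticGeDiv {n} E k = ∀ (m : ℕ) (c : Fin n → Fin m) → ProperColouring E m c → n ≤ m * k

{-# OPTIONS --safe #-}
-- Call a vertex set descending for an ordering π of V(G) when every arc inside
-- it goes from a later to an earlier vertex. An independent set of G_π is
-- descending, and a descending set is acyclic. The earliest vertex of a
-- descending t-set T is a sink of G[T], and the sinks of G[T] are independent,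
-- so at most s^t orderings of T, and at most s^t · n!/t! orderings of V(G),
-- make T descending. As k! ≥ (k/e)^k, the hypothesis gives N · s^k < k!, so
-- some ordering makes no acyclic k-set descending, and then every independent
-- set of G_π has at most k vertices. The ordering is found by conditional
-- expectations, choosing the earliest vertex so as not to increase the
-- potential Σ_T s^|T| · n!/|T|! taken over what is left of the k-sets.
module Submission where

open import Defs
open import Data.Nat using (ℕ; _≤_)
open import Data.Product using (Σ; _×_)
open import Data.Fin using (Fin)
open import Function.Bundles using (_↔_; Inverse)

open import Data.Bool using (Bool; true; false; not; _∧_; if_then_else_)
import Data.Bool as Bool
open import Data.Bool.Properties using (¬-not; T-≡)
open import Data.Empty using (⊥-elim)
open import Data.Fin using (zero; suc; punchIn; punchOut; inject₁; fromℕ; _≟_)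
import Data.Fin as Fin
open import Data.Fin.Induction using (<-weakInduction)
open import Data.Fin.Permutation using (Permutation; Permutation′; insert; insert-punchIn)
import Data.Fin.Permutation as Perm
open import Data.Fin.Properties using (any?; punchInᵢ≢i; punchIn-punchOut)
import Data.Fin.Properties as Finₚ
open import Data.Fin.Subset using (Subset; _∈_; _⊆_; ∣_∣; ⊥)
open import Data.Fin.Subset.Properties using (⊥⊆; ∣⊥∣≡0; in⊆in; out⊆)
open import Data.Irrelevant using ([_])
open import Data.Maybe using (Maybe; just; nothing; maybe′; _>>=_)
open import Data.Maybe.Relation.Unary.All using (All; just; nothing; drop-just)
open import Data.Nat using (zero; suc; _+_; _*_; _^_; _!; _<_; z≤n; s≤s; pred; s<s⁻¹; >-nonZero)
import Data.Nat as ℕ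
open import Data.Nat.Properties hiding (_≟_)
open import Data.Nat.Tactic.RingSolver using (solve-∀)
open import Data.Product using (∃; _,_; proj₁; proj₂; swap)
open import Data.Refinement using (Refinement; _,_)
open import Data.Sum using (inj₁; inj₂)
open import Data.Vec using ([]; _∷_; lookup; tabulate)
open import Data.Vec.Functional using (insertAt)
open import Data.Vec.Functional.Properties using (insertAt-lookup; insertAt-punchIn)
open import Data.Vec.Properties using (lookup∘tabulate; []=⇒lookup; lookup⇒[]=)
open import Function using (_∘_; Injection; Equivalence)
open import Function.Properties.Inverse using (↔⇒↣)
open import Level using (Level)
open import Relation.Binary using (tri<; tri≈; tri>)
open import Relation.Binary.PropositionalEquality
  using (_≡_; refl; sym; trans; cong; cong₂; subst; subst₂; module ≡-Reasoning)
open import Relation.Nullary using (yes; no; does; ¬_)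
open import Relation.Nullary.Decidable using (_×-dec_; dec-true; dec-false; recompute)
open import Relation.Unary using (Pred; Decidable)

open import Algebra.Properties.CommutativeSemigroup *-commutativeSemigroup
  using (interchange; xy∙z≈xz∙y; x∙yz≈y∙xz)
open import Algebra.Properties.Semiring.Sum +-*-semiring
  using (sum; sum-syntax; sum-remove; ∑-distrib-+; ∑-comm; sum-cong-≗; *-distribʳ-sum)

private variable
  ℓ : Level
  m n N : ℕ

-- (k/e)^k ≤ k!

^-distribʳ-* : ∀ m n o → (m * n) ^ o ≡ m ^ o * n ^ o
^-distribʳ-* m n zero    = refl
^-distribʳ-* m n (suc o) = begin
  m * n * (m * n) ^ o      ≡⟨ cong (m * n *_) (^-distribʳ-* m n o) ⟩
  m * n * (m ^ o * n ^ o)  ≡⟨ interchange m n (m ^ o) (n ^ o) ⟩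
  m * m ^ o * (n * n ^ o)  ∎
  where open ≡-Reasoning

n^n>0 : ∀ n → 0 < n ^ n
n^n>0 zero    = s≤s z≤n
n^n>0 (suc n) = m^n>0 (suc n) (suc n)

bernoulli⁺ : ∀ x m → x ^ m * (x + suc m) ≤ suc x ^ suc m
bernoulli⁺ x zero    = ≤-reflexive (base x)
  where
  base : ∀ x → 1 * (x + 1) ≡ suc x * 1
  base = solve-∀
bernoulli⁺ x (suc m) = begin
  x * x ^ m * (x + suc (suc m))          ≡⟨ split x (x ^ m) m ⟩
  x * (x ^ m * (x + suc m)) + x * x ^ m  ≤⟨ +-mono-≤ (*-monoʳ-≤ x (bernoulli⁺ x m)) (^-monoˡ-≤ (suc m) (n≤1+n x)) ⟩
  x * suc x ^ suc m + suc x ^ suc m      ≡⟨ +-comm (x * suc x ^ suc m) _ ⟩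
  suc x * suc x ^ suc m                  ∎
  where
  open ≤-Reasoning
  split : ∀ x y m → x * y * (x + suc (suc m)) ≡ x * (y * (x + suc m)) + x * y
  split = solve-∀

bernoulli⁻ : ∀ x m → suc x ^ suc m ≤ x ^ suc m + suc m * suc x ^ m
bernoulli⁻ x zero    = ≤-reflexive (base x)
  where
  base : ∀ x → suc x * 1 ≡ x * 1 + 1 * 1
  base = solve-∀
bernoulli⁻ x (suc m) = begin
  suc x * X
    ≡⟨ +-comm X (x * X) ⟩
  x * X + X
    ≤⟨ +-monoˡ-≤ X (*-monoʳ-≤ x (bernoulli⁻ x m)) ⟩
  x * (x ^ suc m + suc m * suc x ^ m) + X
    ≡⟨ distrib x (x ^ suc m) (suc m) (suc x ^ m) X ⟩
  x * x ^ suc m + (suc m * (x * suc x ^ m) + X)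
    ≤⟨ +-monoʳ-≤ (x * x ^ suc m) (+-monoˡ-≤ X (*-monoʳ-≤ (suc m) (*-monoˡ-≤ (suc x ^ m) (n≤1+n x)))) ⟩
  x * x ^ suc m + (suc m * X + X)
    ≡⟨ cong (x * x ^ suc m +_) (+-comm (suc m * X) X) ⟩
  x * x ^ suc m + suc (suc m) * X
    ∎
  where
  open ≤-Reasoning
  X = suc x ^ suc m
  distrib : ∀ x a m b c → x * (a + m * b) + c ≡ x * a + (m * (x * b) + c)
  distrib = solve-∀

infix 4 _≤ᵣ_

-- p ≤ᵣ q encodes proj₁ p / proj₂ p ≤ proj₁ q / proj₂ q, for positive denominators.
record _≤ᵣ_ (p q : ℕ × ℕ) : Set where
  constructor cross
  field cross-≤ : proj₁ p * proj₂ q ≤ proj₁ q * proj₂ p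

≤ᵣ-trans : ∀ {p q r} → 0 < proj₂ q → p ≤ᵣ q → q ≤ᵣ r → p ≤ᵣ r
≤ᵣ-trans {a , b} {c , d} {e , f} d>0 (cross ab≤cd) (cross cd≤ef) =
  cross (*-cancelʳ-≤ (a * f) (e * b) d {{>-nonZero d>0}} (begin
    a * f * d  ≡⟨ xy∙z≈xz∙y a f d ⟩
    a * d * f  ≤⟨ *-monoˡ-≤ f ab≤cd ⟩
    c * b * f  ≡⟨ xy∙z≈xz∙y c b f ⟩
    c * f * b  ≤⟨ *-monoˡ-≤ b cd≤ef ⟩
    e * d * b  ≡⟨ xy∙z≈xz∙y e d b ⟩
    e * b * d  ∎))
  where open ≤-Reasoning

≤ᵣ-reciprocal : ∀ {a b c d} → (a , b) ≤ᵣ (c , d) → (d , c) ≤ᵣ (b , a)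
≤ᵣ-reciprocal {a} {b} {c} {d} (cross ab≤cd) = cross (subst₂ _≤_ (*-comm a d) (*-comm c b) ab≤cd)

≤ᵣ-chain : (r : ℕ → ℕ × ℕ) → (∀ i → 0 < proj₂ (r i)) → (∀ i → r i ≤ᵣ r (suc i))
         → ∀ {m n} → m ≤ n → r m ≤ᵣ r n
≤ᵣ-chain r r>0 step {m} m≤n with m≤n⇒∃[o]m+o≡n m≤n
... | o , refl = extend o
  where
  extend : ∀ o → r m ≤ᵣ r (m + o)
  extend zero    rewrite +-identityʳ m = cross ≤-refl
  extend (suc o) rewrite +-suc m o = ≤ᵣ-trans (r>0 (m + o)) (extend o) (step (m + o))

-- (1 + 1/k)^k increases and (1 + 1/j)^(1+j) decreases, both towards e.
e-below e-above : ℕ → ℕ × ℕ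
e-below k = suc k ^ k , k ^ k
e-above j = suc j ^ suc j , j ^ suc j

suc-square : ∀ k → suc k * suc k ≡ suc (k * suc (suc k))
suc-square = solve-∀

-- Both steps are Bernoulli's inequality at x = k(k+2), where x + 1 = (k+1)².
e-below-step : ∀ k → e-below k ≤ᵣ e-below (suc k)
e-below-step zero      = cross (s≤s z≤n)
e-below-step k@(suc _) = cross (*-cancelˡ-≤ k (+-cancelʳ-≤ (suc k * (U * U)) _ _ (begin
  k * (U * (suc k * U)) + suc k * (U * U)
    ≡⟨ expand k U ⟩
  suc k ^ suc k * suc k ^ suc k
    ≡⟨ sym (^-distribʳ-* (suc k) (suc k) (suc k)) ⟩
  (suc k * suc k) ^ suc k
    ≡⟨ cong (_^ suc k) (suc-square k) ⟩
  suc x ^ suc k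
    ≤⟨ bernoulli⁻ x k ⟩
  x ^ suc k + suc k * suc x ^ k
    ≡⟨ cong₂ (λ a b → a + suc k * b) (^-distribʳ-* k (suc (suc k)) (suc k))
             (trans (cong (_^ k) (sym (suc-square k))) (^-distribʳ-* (suc k) (suc k) k)) ⟩
  k * k ^ k * W + suc k * (U * U)
    ≡⟨ cong (_+ suc k * (U * U)) (trans (*-assoc k (k ^ k) W) (cong (k *_) (*-comm (k ^ k) W))) ⟩
  k * (W * k ^ k) + suc k * (U * U)
    ∎)))
  where
  open ≤-Reasoning
  U = suc k ^ k
  W = suc (suc k) ^ suc k
  x = k * suc (suc k)
  expand : ∀ k U → k * (U * (suc k * U)) + suc k * (U * U) ≡ suc k * U * (suc k * U)
  expand = solve-∀

e-above-step : ∀ j → e-above (suc j) ≤ᵣ e-above j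
e-above-step j = cross (*-cancelˡ-≤ (suc j) (begin
  suc j * (suc (suc j) * Y * j ^ suc j)
    ≡⟨ regroup j Y (j ^ suc j) ⟩
  j ^ suc j * Y * (x + suc (suc j))
    ≡⟨ cong (_* (x + suc (suc j))) (sym (^-distribʳ-* j (suc (suc j)) (suc j))) ⟩
  x ^ suc j * (x + suc (suc j))
    ≤⟨ bernoulli⁺ x (suc j) ⟩
  suc x ^ suc (suc j)
    ≡⟨ cong (_^ suc (suc j)) (sym (suc-square j)) ⟩
  (suc j * suc j) ^ suc (suc j)
    ≡⟨ ^-distribʳ-* (suc j) (suc j) (suc (suc j)) ⟩
  suc j * suc j ^ suc j * suc j ^ suc (suc j)
    ≡⟨ *-assoc (suc j) (suc j ^ suc j) _ ⟩
  suc j * (suc j ^ suc j * suc j ^ suc (suc j))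
    ∎))
  where
  open ≤-Reasoning
  Y = suc (suc j) ^ suc j
  x = j * suc (suc j)
  regroup : ∀ j Y J → suc j * (suc (suc j) * Y * J) ≡ J * Y * (j * suc (suc j) + suc (suc j))
  regroup = solve-∀

e-below≤e-above-diag : ∀ k → e-below k ≤ᵣ e-above k
e-below≤e-above-diag k = cross (subst₂ _≤_
  (x∙yz≈y∙xz k (suc k ^ k) (k ^ k)) (sym (*-assoc (suc k) (suc k ^ k) (k ^ k)))
  (*-monoˡ-≤ (suc k ^ k * k ^ k) (n≤1+n k)))

e-below≤e-above : ∀ k j → 1 ≤ j → e-below k ≤ᵣ e-above j
e-below≤e-above k j 1≤j with k ≤? j
... | yes k≤j = ≤ᵣ-trans (n^n>0 j) (≤ᵣ-chain e-below n^n>0 e-below-step k≤j) (e-below≤e-above-diag j)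
... | no  k≰j = ≤ᵣ-trans (m^n>0 k {{>-nonZero (≤-trans 1≤j (<⇒≤ j<k))}} (suc k)) (e-below≤e-above-diag k)
                  (≤ᵣ-reciprocal (≤ᵣ-chain (swap ∘ e-above) (λ i → m^n>0 (suc i) (suc i))
                                   (λ i → ≤ᵣ-reciprocal (e-above-step i)) (<⇒≤ j<k)))
  where
  j<k : j < k
  j<k = ≰⇒> k≰j

-- As e ≤ (1 + 1/j)^(1+j), this gives (k/e)^k ≤ k!.
k^k≤k!·[1+1/j]^[[1+j]k] : ∀ j k → 1 ≤ j → k ^ k * j ^ (suc j * k) ≤ k ! * suc j ^ (suc j * k)
k^k≤k!·[1+1/j]^[[1+j]k] j zero    _   rewrite *-zeroʳ j = ≤-refl
k^k≤k!·[1+1/j]^[[1+j]k] j (suc k) 1≤j = begin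
  suc k ^ suc k * j ^ (suc j * suc k)
    ≡⟨ cong (suc k ^ suc k *_) (^-split j) ⟩
  suc k * suc k ^ k * (j ^ suc j * J)
    ≡⟨ regroup (suc k) (suc k ^ k) (j ^ suc j) J ⟩
  suc k * (suc k ^ k * j ^ suc j) * J
    ≤⟨ *-monoˡ-≤ J (*-monoʳ-≤ (suc k) (_≤ᵣ_.cross-≤ (e-below≤e-above k j 1≤j))) ⟩
  suc k * (suc j ^ suc j * k ^ k) * J
    ≡⟨ regroup′ (suc k) (suc j ^ suc j) (k ^ k) J ⟩
  suc k * suc j ^ suc j * (k ^ k * J)
    ≤⟨ *-monoʳ-≤ (suc k * suc j ^ suc j) (k^k≤k!·[1+1/j]^[[1+j]k] j k 1≤j) ⟩
  suc k * suc j ^ suc j * (k ! * suc j ^ (suc j * k))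
    ≡⟨ interchange (suc k) (suc j ^ suc j) (k !) _ ⟩
  suc k ! * (suc j ^ suc j * suc j ^ (suc j * k))
    ≡⟨ cong (suc k ! *_) (sym (^-split (suc j))) ⟩
  suc k ! * suc j ^ (suc j * suc k)
    ∎
  where
  open ≤-Reasoning
  J = j ^ (suc j * k)
  ^-split : ∀ b → b ^ (suc j * suc k) ≡ b ^ suc j * b ^ (suc j * k)
  ^-split b = trans (cong (b ^_) (*-suc (suc j) k)) (^-distribˡ-+-* b (suc j) (suc j * k))
  regroup : ∀ a b c d → a * b * (c * d) ≡ a * (b * c) * d
  regroup = solve-∀
  regroup′ : ∀ a b c d → a * (b * c) * d ≡ a * b * (c * d)
  regroup′ = solve-∀

fewerThanBound⇒N*s^k<k! : ∀ N s k → FewerThanBound N s k → N * s ^ k < k !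
fewerThanBound⇒N*s^k<k! N s k (i , lt) =
  *-cancelʳ-< _ (N * s ^ k) (k !) (<-≤-trans lt (k^k≤k!·[1+1/j]^[[1+j]k] (suc i) k (s≤s z≤n)))

-- Finite sums and vertex sets

sum-mono-≤ : ∀ {n} {f g : Fin n → ℕ} → (∀ i → f i ≤ g i) → sum f ≤ sum g
sum-mono-≤ {zero}  f≤g = z≤n
sum-mono-≤ {suc n} f≤g = +-mono-≤ (f≤g zero) (sum-mono-≤ (f≤g ∘ suc))

sum-const : ∀ n c → ∑[ i < n ] c ≡ n * c
sum-const zero    c = refl
sum-const (suc n) c = cong (c +_) (sum-const n c)

≤-sum : ∀ {n} (f : Fin n → ℕ) i → f i ≤ sum f
≤-sum {suc n} f i = ≤-trans (m≤m+n (f i) _) (≤-reflexive (sym (sum-remove {i = i} f)))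

sum<*⇒∃< : ∀ {n} (f : Fin n → ℕ) x → sum f < n * x → ∃ λ i → f i < x
sum<*⇒∃< {suc n} f x sum<nx with f zero <? x
... | yes f₀<x = zero , f₀<x
... | no  f₀≮x with sum<*⇒∃< (f ∘ suc) x (+-cancelˡ-< x _ _ (≤-<-trans (+-monoˡ-≤ _ (≮⇒≥ f₀≮x)) sum<nx))
...   | i , fᵢ<x = suc i , fᵢ<x

indicator : Bool → ℕ
indicator b = if b then 1 else 0

size : ∀ {n} → (Fin n → Bool) → ℕ
size {n} S = ∑[ i < n ] indicator (S i)

size-punchIn : ∀ {n} (S : Fin (suc n) → Bool) v {b} → S v ≡ b → size S ≡ indicator b + size (S ∘ punchIn v)
size-punchIn S v refl = sum-remove {i = v} (indicator ∘ S)

size-mono : ∀ {n} {S T : Fin n → Bool} → (∀ {i} → S i ≡ true → T i ≡ true) → size S ≤ size T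
size-mono {S = S} {T} S⊆T = sum-mono-≤ indicator-mono
  where
  indicator-mono : ∀ i → indicator (S i) ≤ indicator (T i)
  indicator-mono i with S i in Sᵢ
  ... | false = z≤n
  ... | true rewrite S⊆T Sᵢ = ≤-refl

size+size-not : ∀ {n} (S : Fin n → Bool) → size S + size (not ∘ S) ≡ n
size+size-not {n} S = begin
  size S + size (not ∘ S)                               ≡⟨ sym (∑-distrib-+ (indicator ∘ S) (indicator ∘ not ∘ S)) ⟩
  ∑[ i < n ] (indicator (S i) + indicator (not (S i)))  ≡⟨ sum-cong-≗ (partition ∘ S) ⟩
  ∑[ i < n ] 1                                          ≡⟨ sum-const n 1 ⟩
  n * 1                                                 ≡⟨ *-identityʳ n ⟩
  n                                                     ∎
  where
  open ≡-Reasoning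
  partition : ∀ b → indicator b + indicator (not b) ≡ 1
  partition true  = refl
  partition false = refl

infixl 8 _↑_

_↑_ : ℕ → ℕ → ℕ
t ↑ zero  = 1
t ↑ suc j = suc (t + j) * t ↑ j

↑-*-! : ∀ t j → t ↑ j * t ! ≡ (t + j) !
↑-*-! t zero    = trans (*-identityˡ (t !)) (cong _! (sym (+-identityʳ t)))
↑-*-! t (suc j) = begin
  suc (t + j) * t ↑ j * t !    ≡⟨ *-assoc (suc (t + j)) (t ↑ j) (t !) ⟩
  suc (t + j) * (t ↑ j * t !)  ≡⟨ cong (suc (t + j) *_) (↑-*-! t j) ⟩
  suc (t + j) !                ≡⟨ cong _! (sym (+-suc t j)) ⟩
  (t + suc j) !                ∎
  where open ≡-Reasoning

↑-suc : ∀ t j → t ↑ suc j ≡ suc t * suc t ↑ j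
↑-suc t zero    = cong (λ m → suc m * 1) (+-identityʳ t)
↑-suc t (suc j) = begin
  suc (t + suc j) * (suc (t + j) * t ↑ j)  ≡⟨ cong (suc (t + suc j) *_) (↑-suc t j) ⟩
  suc (t + suc j) * (suc t * suc t ↑ j)    ≡⟨ x∙yz≈y∙xz (suc (t + suc j)) (suc t) _ ⟩
  suc t * (suc (t + suc j) * suc t ↑ j)    ≡⟨ cong (λ m → suc t * (suc m * suc t ↑ j)) (+-suc t j) ⟩
  suc t * (suc (suc t + j) * suc t ↑ j)    ∎
  where open ≡-Reasoning

-- s^t · (t + j)!/t!: the weight of a t-set with j vertices outside it
weight : ℕ → ℕ → ℕ → ℕ
weight s t j = s ^ t * t ↑ j

-- Placing first one of the j vertices outside a t-set, or one of its q ≤ s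
-- sinks, loses no weight; each pred only matters where its coefficient is nonzero.
weight-recurrence : ∀ {s q} t j → q ≤ s → q ≤ t
                  → j * weight s t (pred j) + q * weight s (pred t) j ≤ weight s t j
weight-recurrence         zero    zero    _   z≤n = z≤n
weight-recurrence {s}     zero    (suc j) _   z≤n = ≤-reflexive (no-sinks j (0 ↑ j) (weight s 0 (suc j)))
  where
  no-sinks : ∀ j X Y → suc j * (1 * X) + 0 * Y ≡ 1 * (suc j * X)
  no-sinks = solve-∀
weight-recurrence {s}     (suc t) zero    q≤s _   =
  ≤-trans (*-monoˡ-≤ (s ^ t * 1) q≤s) (≤-reflexive (sym (*-assoc s (s ^ t) 1)))
weight-recurrence {s} {q} (suc t) (suc j) q≤s _   = begin
  suc j * (s ^ suc t * R) + q * (s ^ t * t ↑ suc j)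
    ≡⟨ cong (λ m → suc j * (s ^ suc t * R) + q * (s ^ t * m)) (↑-suc t j) ⟩
  suc j * (s ^ suc t * R) + q * (s ^ t * (suc t * R))
    ≤⟨ +-monoʳ-≤ (suc j * (s ^ suc t * R)) (*-monoˡ-≤ (s ^ t * (suc t * R)) q≤s) ⟩
  suc j * (s ^ suc t * R) + s * (s ^ t * (suc t * R))
    ≡⟨ collect s t j (s ^ t) R ⟩
  s ^ suc t * suc t ↑ suc j
    ∎
  where
  open ≤-Reasoning
  R = suc t ↑ j
  collect : ∀ s t j S R → suc j * (s * S * R) + s * (S * (suc t * R)) ≡ s * S * (suc (suc t + j) * R)
  collect = solve-∀

-- Orderings avoiding descending sets

Descending : Digraph n → (Fin n → Fin m) → Pred (Fin n) ℓ → Set ℓ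
Descending E ρ P = ∀ {u w} → P u → P w → E u w ≡ true → ρ w Fin.< ρ u

⟦_⟧ : (Fin n → Bool) → Pred (Fin n) _
⟦ T ⟧ u = T u ≡ true

NotDescending : Digraph n → (Fin n → Fin m) → (Fin n → Bool) → Set
NotDescending E ρ T = ¬ Descending E ρ ⟦ T ⟧

IndepNumberLeᵇ : Digraph n → ℕ → Set
IndepNumberLeᵇ {n} E s =
  ∀ (S : Fin n → Bool) → (∀ {u w} → S u ≡ true → S w ≡ true → E u w ≡ false) → size S ≤ s

restrict : Digraph (suc n) → Fin (suc n) → Digraph n
restrict E v i j = E (punchIn v i) (punchIn v j)

insertAt-false-member : ∀ (S : Fin n → Bool) v {u} → insertAt S v false u ≡ true
                      → ∃ λ u′ → punchIn v u′ ≡ u × S u′ ≡ true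
insertAt-false-member S v {u} Sᵤ with v ≟ u
... | yes refl with () ← trans (sym (insertAt-lookup S v false)) Sᵤ
... | no  v≢u = punchOut v≢u , punchIn-punchOut v≢u ,
                trans (sym (insertAt-punchIn S v false (punchOut v≢u)))
                      (subst (λ x → insertAt S v false x ≡ true) (sym (punchIn-punchOut v≢u)) Sᵤ)

restrict-indepNumberLeᵇ : ∀ (E : Digraph (suc n)) v {s} → IndepNumberLeᵇ E s → IndepNumberLeᵇ (restrict E v) s
restrict-indepNumberLeᵇ E v α S independent = subst (_≤ _) size-insertAt (α (insertAt S v false) lifted)
  where
  size-insertAt : size (insertAt S v false) ≡ size S
  size-insertAt = trans (size-punchIn (insertAt S v false) v (insertAt-lookup S v false))
                        (sum-cong-≗ (cong indicator ∘ insertAt-punchIn S v false))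
  lifted : ∀ {u w} → insertAt S v false u ≡ true → insertAt S v false w ≡ true → E u w ≡ false
  lifted Sᵤ S_w with insertAt-false-member S v Sᵤ | insertAt-false-member S v S_w
  ... | u′ , refl , S′ᵤ | w′ , refl , S′_w = independent S′ᵤ S′_w

HasOutArcIn : Digraph n → (Fin n → Bool) → Pred (Fin n) _
HasOutArcIn E T v = ∃ λ x → T x ≡ true × E v x ≡ true

-- Opaque, so that `with hasOutArcIn? E T v` also abstracts it inside sinks and shrink.
opaque
  hasOutArcIn? : (E : Digraph n) (T : Fin n → Bool) → Decidable (HasOutArcIn E T)
  hasOutArcIn? E T v = any? (λ x → (T x Bool.≟ true) ×-dec (E v x Bool.≟ true))

sinks : Digraph n → (Fin n → Bool) → Fin n → Bool
sinks E T v = T v ∧ not (does (hasOutArcIn? E T v))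

-- What is left of T once v is put first in the ordering: nothing if T can then
-- no longer be descending.
shrink : Digraph (suc n) → Fin (suc n) → (Fin (suc n) → Bool) → Maybe (Fin n → Bool)
shrink E v T = if T v ∧ does (hasOutArcIn? E T v) then nothing else just (T ∘ punchIn v)

sink⇒member : ∀ (E : Digraph n) T {v} → sinks E T v ≡ true → T v ≡ true
sink⇒member E T {v} sinkᵥ with T v
... | true = refl

sink⇒noOutArc : ∀ (E : Digraph n) T {v} → sinks E T v ≡ true → ¬ HasOutArcIn E T v
sink⇒noOutArc E T {v} sinkᵥ with T v | hasOutArcIn? E T v
... | true | no noArc = noArc

sinks-independent : ∀ (E : Digraph n) T {u w} → sinks E T u ≡ true → sinks E T w ≡ true → E u w ≡ false
sinks-independent E T {u} {w} sinkᵤ sink_w =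
  ¬-not (λ Eᵤw → sink⇒noOutArc E T sinkᵤ (w , sink⇒member E T sink_w , Eᵤw))

shrink-minimum : ∀ (E : Digraph (suc n)) (ρ : Fin (suc n) → Fin (suc m)) T {v} → ρ v ≡ zero
               → Descending E ρ ⟦ T ⟧ → shrink E v T ≡ just (T ∘ punchIn v)
shrink-minimum E ρ T {v} ρᵥ≡0 descending with T v in Tᵥ | hasOutArcIn? E T v
... | true  | yes (x , Tₓ , Eᵥₓ) = ⊥-elim (n≮0 (subst (λ y → ρ x Fin.< y) ρᵥ≡0 (descending Tᵥ Tₓ Eᵥₓ)))
... | true  | no  _ = refl
... | false | _     = refl

insert-pivot : ∀ v w (π : Permutation m n) → Inverse.to (insert v w π) v ≡ w
insert-pivot v w π with v ≟ v
... | yes _   = refl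
... | no  v≢v = ⊥-elim (v≢v refl)

descending-insert⁻ : ∀ (E : Digraph (suc n)) v (π : Permutation′ n) {P : Pred (Fin (suc n)) ℓ}
                   → Descending E (Inverse.to (insert v zero π)) P
                   → Descending (restrict E v) (Inverse.to π) (P ∘ punchIn v)
descending-insert⁻ E v π descending Pᵤ P_w Eᵤw =
  s<s⁻¹ (subst₂ Fin._<_ (insert-punchIn v zero π _) (insert-punchIn v zero π _) (descending Pᵤ P_w Eᵤw))

module _ (s : ℕ) where

  setWeight : (Fin n → Bool) → ℕ
  setWeight T = weight s (size T) (size (not ∘ T))

  weight? : Maybe (Fin n → Bool) → ℕ
  weight? = maybe′ setWeight 0

  weight?-shrink : ∀ (E : Digraph (suc n)) T v →
    weight? (shrink E v T) ≤ indicator (not (T v)) * weight s (size T) (pred (size (not ∘ T)))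
                             + indicator (sinks E T v) * weight s (pred (size T)) (size (not ∘ T))
  weight?-shrink E T v with T v in Tᵥ | hasOutArcIn? E T v
  ... | true  | yes _ = z≤n
  ... | true  | no  _ = ≤-reflexive (trans
        (cong₂ (weight s) (cong pred (sym (size-punchIn T v Tᵥ))) (sym (size-punchIn (not ∘ T) v (cong not Tᵥ))))
        (sym (+-identityʳ _)))
  ... | false | _     = ≤-trans (≤-reflexive (trans
        (cong₂ (weight s) (sym (size-punchIn T v Tᵥ)) (cong pred (sym (size-punchIn (not ∘ T) v (cong not Tᵥ)))))
        (sym (+-identityʳ _)))) (m≤m+n _ _)

  ∑-weight?-shrink : ∀ (E : Digraph (suc n)) → IndepNumberLeᵇ E s → ∀ T →
                     ∑[ v < suc n ] weight? (shrink E v T) ≤ setWeight T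
  ∑-weight?-shrink {n} E α T = begin
    ∑[ v < suc n ] weight? (shrink E v T)
      ≤⟨ sum-mono-≤ (weight?-shrink E T) ⟩
    ∑[ v < suc n ] (indicator (not (T v)) * A + indicator (sinks E T v) * B)
      ≡⟨ ∑-distrib-+ (λ v → indicator (not (T v)) * A) (λ v → indicator (sinks E T v) * B) ⟩
    ∑[ v < suc n ] (indicator (not (T v)) * A) + ∑[ v < suc n ] (indicator (sinks E T v) * B)
      ≡⟨ sym (cong₂ _+_ (*-distribʳ-sum A (indicator ∘ not ∘ T)) (*-distribʳ-sum B (indicator ∘ sinks E T))) ⟩
    size (not ∘ T) * A + size (sinks E T) * B
      ≤⟨ weight-recurrence (size T) (size (not ∘ T)) (α (sinks E T) (sinks-independent E T))
                           (size-mono (λ {v} → sink⇒member E T {v})) ⟩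
    setWeight T
      ∎
    where
    open ≤-Reasoning
    A = weight s (size T) (pred (size (not ∘ T)))
    B = weight s (pred (size T)) (size (not ∘ T))

  potential : (Fin N → Maybe (Fin n → Bool)) → ℕ
  potential {N} F = ∑[ i < N ] weight? (F i)

  potential-shrink : ∀ (E : Digraph (suc n)) → IndepNumberLeᵇ E s → (F : Fin N → Maybe (Fin (suc n) → Bool))
                   → ∑[ v < suc n ] potential (λ i → F i >>= shrink E v) ≤ potential F
  potential-shrink {n} {N} E α F = begin
    ∑[ v < suc n ] ∑[ i < N ] weight? (F i >>= shrink E v)  ≡⟨ ∑-comm (λ v i → weight? (F i >>= shrink E v)) ⟩
    ∑[ i < N ] ∑[ v < suc n ] weight? (F i >>= shrink E v)  ≤⟨ sum-mono-≤ shrink-each ⟩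
    potential F                                             ∎
    where
    open ≤-Reasoning
    shrink-each : ∀ i → ∑[ v < suc n ] weight? (F i >>= shrink E v) ≤ weight? (F i)
    shrink-each i with F i
    ... | nothing = ≤-reflexive (trans (sum-const (suc n) 0) (*-zeroʳ n))
    ... | just T  = ∑-weight?-shrink E α T

  descent-avoiding-permutation : ∀ n (E : Digraph n) → IndepNumberLeᵇ E s → (F : Fin N → Maybe (Fin n → Bool))
    → potential F < n ! → Σ (Permutation′ n) λ π → ∀ i → All (NotDescending E (Inverse.to π)) (F i)
  descent-avoiding-permutation zero E α F potential<1 = Perm.id , all-nothing
    where
    all-nothing : ∀ i → All (NotDescending E (Inverse.to Perm.id)) (F i)
    all-nothing i with F i in Fᵢ
    ... | nothing = nothing
    ... | just T  = ⊥-elim (<⇒≱ potential<1 (subst (λ m → weight? m ≤ potential F) Fᵢ (≤-sum (weight? ∘ F) i)))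
  descent-avoiding-permutation (suc n) E α F potential<
    -- the potentials left by the 1 + n choices of first vertex sum to less than (1 + n) · n!
    with sum<*⇒∃< (λ v → potential (λ i → F i >>= shrink E v)) (n !) (≤-<-trans (potential-shrink E α F) potential<)
  ... | v , potential′<
    with descent-avoiding-permutation n (restrict E v) (restrict-indepNumberLeᵇ E v α)
                                      (λ i → F i >>= shrink E v) potential′<
  ...   | π′ , avoids = π , λ i → lift (F i) (avoids i)
    where
    π : Permutation′ (suc n)
    π = insert v zero π′
    lift : ∀ m → All (NotDescending (restrict E v) (Inverse.to π′)) (m >>= shrink E v)
         → All (NotDescending E (Inverse.to π)) m
    lift nothing  _       = nothing
    lift (just T) avoids′ = just λ descending →
      drop-just (subst (All _) (shrink-minimum E (Inverse.to π) T (insert-pivot v zero π′) descending) avoids′)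
                (descending-insert⁻ E v π′ descending)

  setWeight-*-! : ∀ (T : Fin n → Bool) → setWeight T * size T ! ≡ s ^ size T * n !
  setWeight-*-! {n} T = begin
    s ^ t * t ↑ j * t !    ≡⟨ *-assoc (s ^ t) (t ↑ j) (t !) ⟩
    s ^ t * (t ↑ j * t !)  ≡⟨ cong (s ^ t *_) (↑-*-! t j) ⟩
    s ^ t * (t + j) !      ≡⟨ cong (λ m → s ^ t * m !) (size+size-not T) ⟩
    s ^ t * n !            ∎
    where
    open ≡-Reasoning
    t = size T
    j = size (not ∘ T)

  potential-uniform< : ∀ {k} (T : Fin N → Fin n → Bool) → (∀ i → size (T i) ≡ k) → N * s ^ k < k !
                     → potential (λ i → just (T i)) < n !
  potential-uniform< {N} {n} {k} T size≡k N*s^k<k! =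
    *-cancelʳ-< (k !) (potential (λ i → just (T i))) (n !) (begin-strict
      potential (λ i → just (T i)) * k !  ≡⟨ *-distribʳ-sum (k !) (setWeight ∘ T) ⟩
      ∑[ i < N ] (setWeight (T i) * k !)  ≡⟨ sum-cong-≗ weighted ⟩
      ∑[ i < N ] (s ^ k * n !)            ≡⟨ sum-const N _ ⟩
      N * (s ^ k * n !)                   ≡⟨ sym (*-assoc N (s ^ k) (n !)) ⟩
      N * s ^ k * n !                     <⟨ *-monoˡ-< (n !) {{n !≢0}} N*s^k<k! ⟩
      k ! * n !                           ≡⟨ *-comm (k !) (n !) ⟩
      n ! * k !                           ∎)
    where
    open ≤-Reasoning
    weighted : ∀ i → setWeight (T i) * k ! ≡ s ^ k * n !
    weighted i = subst (λ t → setWeight (T i) * t ! ≡ s ^ t * n !) (size≡k i) (setWeight-*-! (T i))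

-- Acyclic sets and independent sets of G_π

∣p∣≡size : ∀ (p : Subset n) → ∣ p ∣ ≡ size (lookup p)
∣p∣≡size []          = refl
∣p∣≡size (true ∷ p)  = cong suc (∣p∣≡size p)
∣p∣≡size (false ∷ p) = ∣p∣≡size p

indepNumberLe⇒indepNumberLeᵇ : ∀ (E : Digraph n) {s} → IndepNumberLe E s → IndepNumberLeᵇ E s
indepNumberLe⇒indepNumberLeᵇ E {s} α S independent =
  subst (_≤ s) size-tabulate (α (tabulate S) tabulate-independent)
  where
  member : ∀ {u} → u ∈ tabulate S → S u ≡ true
  member {u} u∈S = trans (sym (lookup∘tabulate S u)) ([]=⇒lookup u∈S)
  size-tabulate : ∣ tabulate S ∣ ≡ size S
  size-tabulate = trans (∣p∣≡size (tabulate S)) (sum-cong-≗ (cong indicator ∘ lookup∘tabulate S))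
  tabulate-independent : Independent E (tabulate S)
  tabulate-independent u w u∈S w∈S (inj₁ Eᵤw) with () ← trans (sym (independent (member u∈S) (member w∈S))) Eᵤw
  tabulate-independent u w u∈S w∈S (inj₂ E_wu) with () ← trans (sym (independent (member w∈S) (member u∈S))) E_wu

∑-indicator-≟ : ∀ (x : Fin m) → ∑[ c < m ] indicator (does (x ≟ c)) ≡ 1
∑-indicator-≟ {suc m} x = begin
  ∑[ c < suc m ] indicator (does (x ≟ c))
    ≡⟨ sum-remove {i = x} (λ c → indicator (does (x ≟ c))) ⟩
  indicator (does (x ≟ x)) + ∑[ c < m ] indicator (does (x ≟ punchIn x c))
    ≡⟨ cong₂ _+_ (cong indicator (dec-true (x ≟ x) refl))
                 (sum-cong-≗ λ c → cong indicator (dec-false (x ≟ punchIn x c) (punchInᵢ≢i x c ∘ sym))) ⟩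
  1 + ∑[ c < m ] 0
    ≡⟨ cong suc (trans (sum-const m 0) (*-zeroʳ m)) ⟩
  1
    ∎
  where open ≡-Reasoning

indepNumberLeᵇ⇒chromaticGeDiv : ∀ (G : Digraph n) {k} → IndepNumberLeᵇ G k → ChromaticGeDiv G k
indepNumberLeᵇ⇒chromaticGeDiv {n} G {k} α m colour proper = begin
  n                                                  ≡⟨ sym (trans (sum-const n 1) (*-identityʳ n)) ⟩
  ∑[ u < n ] 1                                       ≡⟨ sum-cong-≗ (sym ∘ ∑-indicator-≟ ∘ colour) ⟩
  ∑[ u < n ] ∑[ c < m ] indicator (colourClass c u)  ≡⟨ ∑-comm (λ u c → indicator (colourClass c u)) ⟩
  ∑[ c < m ] size (colourClass c)                    ≤⟨ sum-mono-≤ (λ c → α (colourClass c) (colourClass-independent c)) ⟩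
  ∑[ c < m ] k                                       ≡⟨ sum-const m k ⟩
  m * k                                              ∎
  where
  open ≤-Reasoning
  colourClass : Fin m → Fin n → Bool
  colourClass c u = does (colour u ≟ c)
  coloured : ∀ {c u} → colourClass c u ≡ true → colour u ≡ c
  coloured {c} {u} cᵤ with colour u ≟ c
  ... | yes colourᵤ≡c = colourᵤ≡c
  colourClass-independent : ∀ c {u w} → colourClass c u ≡ true → colourClass c w ≡ true → G u w ≡ false
  colourClass-independent c {u} {w} cᵤ c_w =
    ¬-not λ Gᵤw → proper u w (inj₁ Gᵤw) (trans (coloured cᵤ) (sym (coloured c_w)))

descending-⊆ : ∀ {ℓ₁ ℓ₂} (E : Digraph n) (ρ : Fin n → Fin m) {P : Pred (Fin n) ℓ₁} {Q : Pred (Fin n) ℓ₂}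
             → (∀ {u} → P u → Q u) → Descending E ρ Q → Descending E ρ P
descending-⊆ E ρ P⊆Q descending Pᵤ P_w = descending (P⊆Q Pᵤ) (P⊆Q P_w)

independent-Sub⇒descending : ∀ (E : Digraph n) → IsOrientation E → (π : Fin n ↔ Fin n) {S : Subset n}
                           → Independent (Sub E (Inverse.to π)) S → Descending E (Inverse.to π) (_∈ S)
independent-Sub⇒descending E orientation π {S} independent {u} {w} u∈S w∈S Eᵤw
  with Finₚ.<-cmp (Inverse.to π w) (Inverse.to π u)
... | tri< πw<πu _ _ = πw<πu
... | tri≈ _ πw≡πu _ with refl ← Injection.injective (↔⇒↣ π) πw≡πu
  with () ← trans (sym Eᵤw) (orientation u u Eᵤw)
... | tri> _ _ πu<πw =
  ⊥-elim (independent u w u∈S w∈S (inj₁ (trans (cong (_∧ _) Eᵤw) (Equivalence.to T-≡ (<⇒<ᵇ πu<πw)))))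

descending⇒acyclic : ∀ (E : Digraph n) (ρ : Fin n → Fin m) {S : Subset n}
                   → Descending E ρ (_∈ S) → ¬ DirectedCycleIn E S
descending⇒acyclic E ρ descending cycle =
  <⇒≱ (descending (inS (fromℕ length)) (inS zero) close) (below-start (fromℕ length))
  where
  open DirectedCycleIn cycle renaming (m to length)
  below-start : ∀ i → ρ (f i) Fin.≤ ρ (f zero)
  below-start = <-weakInduction (λ i → ρ (f i) Fin.≤ ρ (f zero)) ≤-refl
    λ i ρfᵢ≤ρf₀ → ≤-trans (<⇒≤ (descending (inS (inject₁ i)) (inS (suc i)) (step i))) ρfᵢ≤ρf₀

subset-ofSize : ∀ k (p : Subset n) → k ≤ ∣ p ∣ → ∃ λ q → q ⊆ p × ∣ q ∣ ≡ k
subset-ofSize {n} zero    p           _        = ⊥ , ⊥⊆ , ∣⊥∣≡0 n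
subset-ofSize     (suc k) (true ∷ p)  (s≤s k≤) with subset-ofSize k p k≤
... | q , q⊆p , ∣q∣≡k = true ∷ q , in⊆in q⊆p , cong suc ∣q∣≡k
subset-ofSize     (suc k) (false ∷ p) k<       with subset-ofSize (suc k) p k<
... | q , q⊆p , ∣q∣≡k = false ∷ q , out⊆ q⊆p , ∣q∣≡k

indepNumberLe-Sub : ∀ (E : Digraph n) → IsOrientation E → (π : Fin n ↔ Fin n) {k : ℕ}
                  → (∀ V → AcyclicKSet E k V → ¬ Descending E (Inverse.to π) (_∈ V))
                  → IndepNumberLe (Sub E (Inverse.to π)) k
indepNumberLe-Sub E orientation π {k} noneDescending S independent with ∣ S ∣ ≤? k
... | yes ∣S∣≤k = ∣S∣≤k
... | no  ∣S∣≰k with subset-ofSize k S (<⇒≤ (≰⇒> ∣S∣≰k))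
...   | V , V⊆S , ∣V∣≡k =
  ⊥-elim (noneDescending V (∣V∣≡k , descending⇒acyclic E (Inverse.to π) V-descending) V-descending)
  where
  V-descending : Descending E (Inverse.to π) (_∈ V)
  V-descending = descending-⊆ E (Inverse.to π) V⊆S (independent-Sub⇒descending E orientation π independent)

acyclicKSet-size : ∀ {E : Digraph n} {k} (V : Refinement (Subset n) (AcyclicKSet E k)) → ∣ Refinement.value V ∣ ≡ k
acyclicKSet-size {k = k} (V , [ acyclic ]) = recompute (∣ V ∣ ℕ.≟ k) (proj₁ acyclic)

acyclicKSets-descent-avoiding-permutation :
  ∀ {n} (E : Digraph n) {s k N} → IndepNumberLe E s → NumAcyclicKSets E k N → N * s ^ k < k !
  → Σ (Fin n ↔ Fin n) λ π → ∀ V → AcyclicKSet E k V → ¬ Descending E (Inverse.to π) (_∈ V)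
acyclicKSets-descent-avoiding-permutation {n} E {s} {k} {N} α acyclicKSets N*s^k<k! = π , noneDescending
  where
  kSet : Fin N → Subset n
  kSet = Refinement.value ∘ Inverse.to acyclicKSets

  kSet-size : ∀ i → size (lookup (kSet i)) ≡ k
  kSet-size i = trans (sym (∣p∣≡size (kSet i))) (acyclicKSet-size (Inverse.to acyclicKSets i))

  avoiding : Σ (Permutation′ n) λ π → ∀ i → All (NotDescending E (Inverse.to π)) (just (lookup (kSet i)))
  avoiding = descent-avoiding-permutation s n E (indepNumberLe⇒indepNumberLeᵇ E α) (λ i → just (lookup (kSet i)))
               (potential-uniform< s (lookup ∘ kSet) kSet-size N*s^k<k!)

  π : Fin n ↔ Fin n
  π = proj₁ avoiding

  noneDescending : ∀ V → AcyclicKSet E k V → ¬ Descending E (Inverse.to π) (_∈ V)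
  noneDescending V acyclic descending =
    drop-just (subst (λ W → All (NotDescending E (Inverse.to π)) (just (lookup W))) kSet-i≡V (proj₂ avoiding i))
              (descending-⊆ E (Inverse.to π) (lookup⇒[]= _ V) descending)
    where
    i : Fin N
    i = Inverse.from acyclicKSets (V , [ acyclic ])
    kSet-i≡V : kSet i ≡ V
    kSet-i≡V = cong Refinement.value (Inverse.strictlyInverseˡ acyclicKSets (V , [ acyclic ]))

corollary2p3 : (n s k : ℕ) → 1 ≤ s → 1 ≤ k → (E : Digraph n) → IsOrientation E
    → IndepNumberLe E s → (N : ℕ) → NumAcyclicKSets E k N → FewerThanBound N s k
    → Σ (Fin n ↔ Fin n) (λ π → IndepNumberLe (Sub E (Inverse.to π)) k
                             × ChromaticGeDiv (Sub E (Inverse.to π)) k)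
corollary2p3 n s k _ _ E orientation α N acyclicKSets fewer =
  π , α-Gπ , indepNumberLeᵇ⇒chromaticGeDiv (Sub E (Inverse.to π)) (indepNumberLe⇒indepNumberLeᵇ _ α-Gπ)
  where
  ordering : Σ (Fin n ↔ Fin n) λ π → ∀ V → AcyclicKSet E k V → ¬ Descending E (Inverse.to π) (_∈ V)
  ordering = acyclicKSets-descent-avoiding-permutation E α acyclicKSets (fewerThanBound⇒N*s^k<k! N s k fewer)

  π : Fin n ↔ Fin n
  π = proj₁ ordering

  α-Gπ : IndepNumberLe (Sub E (Inverse.to π)) k
  α-Gπ = indepNumberLe-Sub E orientation π (proj₂ ordering)
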